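{- Let $H$ be a hypergraph with $V(H)=\{v_1,\ldots,v_n\}$ and let $\emptyset\neq I\subseteq\{1,\ldots,n\}$, $V'=\{v_i: i\in I\}$. If $G_1$ is the strong subhypergraph of $H$ induced by $V'$ and $G_2$ is the weak subhypergraph of $H$ induced by $V'$, then $b(G_2)\leq b(G_1)$ and $b_L(G_2)\leq b_L(G_1)$.
   Context: A hypergraph $H$ consists of a nonempty finite vertex set $V(H)$ and a finite family $E(H)$ of edges, each a subset of $V(H)$; parallel, singleton and empty edges are allowed. The strong subhypergraph induced by $V'\subseteq V(H)$ has vertex set $V'$ and edge family consisting of those edges $e\in E(H)$ with $e\subseteq V'$. The weak subhypergraph induced by $V'$ has vertex set $V'$ and edge family consisting of $e\cap V'$ for each $e\in E(H)$ with $e\cap V'\neq\emptyset$ (one edge for each such $e$; singleton edges may arise). Round-based burning: let $F_0=\emptyset$. In each round $r=1,2,\ldots$ simultaneously: every vertex $v\notin F_{r-1}$ for which there is an edge $e$ with $|e|\geq 2$, $v\in e$ and $e\setminus\{v\}\subseteq F_{r-1}$ catches fire; and a chosen vertex $u_r\notin F_{r-1}$ (a source) is set on fire. $F_r$ is $F_{r-1}$ together with all vertices set on fire in round $r$. A sequence $(u_1,\ldots,u_k)$ with $u_r\notin F_{r-1}$ for all $r$ and $F_k=V(H)$ is a burning sequence; $b(H)$ is the minimum length of a burning sequence. Lazy burning: a set $S\subseteq V(H)$ is set on fire; then repeatedly any unburned vertex $v$ lying in an edge $e$ with $|e|\geq 2$ such that all vertices of $e\setminus\{v\}$ are on fire catches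 fire; $S$ is a lazy burning set if eventually all vertices are on fire; $b_L(H)$ is the minimum size of a lazy burning set. -}

module Defs where

open import Data.Nat using (ℕ; _≤_; _<_; _≤ᵇ_)
open import Data.Bool using (Bool; true; false; _∧_; _∨_)
open import Data.Fin using (Fin)
open import Data.Fin.Subset using (Subset; _∈_; _∉_; _⊆_; _∩_; _∪_; _-_; ∣_∣; ⁅_⁆; ⊥; Nonempty)
open import Data.Fin.Subset.Properties using (_⊆?_; nonempty?; _∈?_)
open import Data.List using (List; []; _∷_; filter; map; length)
open import Data.Bool.ListAction using (any)
open import Data.List.Membership.Propositional using () renaming (_∈_ to _∈ˡ_)
open import Data.Vec using (tabulate)
open import Data.Product using (_×_; Σ)
open import Data.Unit using (⊤)
open import Relation.Nullary using (does; ¬_)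
open import Relation.Binary.PropositionalEquality using (_≡_; _≢_)

-- A hypergraph whose vertex set is a subset `verts` of Fin n
-- (so induced subhypergraphs keep the original vertex names).
-- Edges form a list (a finite family; parallel/singleton/empty edges allowed).
record Hypergraph (n : ℕ) : Set where
  constructor mkHypergraph
  field
    verts : Subset n
    edges : List (Subset n)
open Hypergraph public

fullHypergraph : ∀ {n} → List (Subset n) → Hypergraph n
fullHypergraph E = mkHypergraph Data.Fin.Subset.⊤ E

strongSub : ∀ {n} → Hypergraph n → Subset n → Hypergraph n
strongSub H I = mkHypergraph I (filter (λ e → e ⊆? I) (edges H))

weakSub : ∀ {n} → Hypergraph n → Subset n → Hypergraph n
weakSub H I = mkHypergraph I (map (λ e → e ∩ I) (filter (λ e → nonempty? (e ∩ I)) (edges H)))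

catchesᵇ : ∀ {n} → Subset n → Subset n → Fin n → Bool
catchesᵇ F e v = does (v ∈? e) ∧ (2 ≤ᵇ ∣ e ∣) ∧ does ((e - v) ⊆? F)

spread : ∀ {n} → List (Subset n) → Subset n → Subset n
spread E F = tabulate (λ v → any (λ e → catchesᵇ F e v) E)

step : ∀ {n} → List (Subset n) → Subset n → Fin n → Subset n
step E F u = F ∪ spread E F ∪ ⁅ u ⁆

burnFrom : ∀ {n} → List (Subset n) → Subset n → List (Fin n) → Subset n
burnFrom E F []       = F
burnFrom E F (u ∷ us) = burnFrom E (step E F u) us

ValidSources : ∀ {n} → Hypergraph n → Subset n → List (Fin n) → Set
ValidSources H F []       = ⊤
ValidSources H F (u ∷ us) = u ∈ verts H × u ∉ F × ValidSources H (step (edges H) F u) us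

IsBurningSequence : ∀ {n} → Hypergraph n → List (Fin n) → Set
IsBurningSequence H us = ValidSources H ⊥ us × burnFrom (edges H) ⊥ us ≡ verts H

IsBurningNumber : ∀ {n} → Hypergraph n → ℕ → Set
IsBurningNumber {n} H k =
  Σ (List (Fin n)) (λ us → IsBurningSequence H us × length us ≡ k)
  × (∀ us → IsBurningSequence H us → k ≤ length us)

data LazyBurnt {n} (H : Hypergraph n) (S : Subset n) : Fin n → Set where
  source : ∀ {v} → v ∈ S → LazyBurnt H S v
  spreadTo : ∀ {v} (e : Subset n) → e ∈ˡ edges H → v ∈ e → 2 ≤ ∣ e ∣ →
             (∀ w → w ∈ e → w ≢ v → LazyBurnt H S w) → LazyBurnt H S v

IsLazyBurningSet : ∀ {n} → Hypergraph n → Subset n → Set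
IsLazyBurningSet H S = S ⊆ verts H × (∀ v → v ∈ verts H → LazyBurnt H S v)

IsLazyBurningNumber : ∀ {n} → Hypergraph n → ℕ → Set
IsLazyBurningNumber {n} H k =
  Σ (Subset n) (λ S → IsLazyBurningSet H S × ∣ S ∣ ≡ k)
  × (∀ S → IsLazyBurningSet H S → k ≤ ∣ S ∣)

-- Intersecting with V' leaves every edge of H that lies inside V' unchanged, so every
-- edge of the strong subhypergraph that can ignite anything (i.e. is nonempty) is also an
-- edge of the weak one, and the weak one has no edge leaving V'. Burning only speeds up
-- when edges are added: a lazy burning set stays one, and a burning sequence can be
-- replayed round by round, replacing a source that is already on fire by any vertex that
-- is not (or stopping early once everything burns), so the burned set of the replay always
-- contains the original one.
module Submission where

open import Defs
open import Data.Nat using (ℕ; _≤_; _≤ᵇ_; z≤n; s≤s)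
open import Data.Nat.Properties using (≤-trans; ≤ᵇ⇒≤; ≤⇒≤ᵇ)
open import Data.Bool using (Bool; true; false; T)
open import Data.Bool.Properties using (T-∧; T-≡)
open import Data.Fin using (Fin; zero; suc)
open import Data.Fin.Subset
open import Data.Fin.Subset.Properties
open import Data.List using (List; []; _∷_; length)
open import Data.List.Relation.Unary.Any.Properties using (any⁺; any⁻)
open import Data.List.Membership.Propositional using (find; lose) renaming (_∈_ to _∈ˡ_)
open import Data.List.Membership.Propositional.Properties using (∈-map⁺; ∈-map⁻; ∈-filter⁺; ∈-filter⁻)
open import Data.Vec using (here; there; tabulate) renaming ([] to []ᵛ; _∷_ to _∷ᵛ_)
open import Data.Vec.Properties using (lookup∘tabulate; []=⇒lookup; lookup⇒[]=)
open import Data.Product using (_×_; _,_; ∃-syntax; proj₁)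
open import Data.Sum using (_⊎_; inj₁; inj₂)
open import Data.Unit using (tt)
open import Function using (_∘_; Equivalence)
open import Relation.Nullary using (Dec; does; yes; no)
open import Relation.Binary.PropositionalEquality using (_≡_; refl; sym; trans; subst)

private
  variable
    n : ℕ

⊆-or-witness : (p q : Subset n) → p ⊆ q ⊎ ∃[ x ] (x ∈ p × x ∉ q)
⊆-or-witness []ᵛ      []ᵛ      = inj₁ (λ ())
⊆-or-witness (s ∷ᵛ p) (t ∷ᵛ q) with ⊆-or-witness p q
... | inj₂ (x , x∈p , x∉q) = inj₂ (suc x , there x∈p , λ { (there x∈q) → x∉q x∈q })
⊆-or-witness (true  ∷ᵛ p) (false ∷ᵛ q) | inj₁ _   = inj₂ (zero , here , λ ())
⊆-or-witness (false ∷ᵛ p) (t     ∷ᵛ q) | inj₁ p⊆q = inj₁ λ { (there x∈p) → there (p⊆q x∈p) }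
⊆-or-witness (true  ∷ᵛ p) (true  ∷ᵛ q) | inj₁ p⊆q =
  inj₁ λ { here → here ; (there x∈p) → there (p⊆q x∈p) }

p⊆q⇒p∩q≡p : {p q : Subset n} → p ⊆ q → p ∩ q ≡ p
p⊆q⇒p∩q≡p {p = p} {q} p⊆q = ⊆-antisym (p∩q⊆p p q) (λ x∈p → x∈p∩q⁺ (x∈p , p⊆q x∈p))

T-does⁻ : ∀ {P : Set} (P? : Dec P) → T (does P?) → P
T-does⁻ (yes p) _ = p

T-does⁺ : ∀ {P : Set} (P? : Dec P) → P → T (does P?)
T-does⁺ (yes _) _ = _
T-does⁺ (no ¬p) p = ¬p p

∈-tabulate⁻ : ∀ (f : Fin n → Bool) {v} → v ∈ tabulate f → T (f v)
∈-tabulate⁻ f {v} v∈ =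
  Equivalence.from T-≡ (trans (sym (lookup∘tabulate f v)) ([]=⇒lookup v∈))

∈-tabulate⁺ : ∀ (f : Fin n → Bool) {v} → T (f v) → v ∈ tabulate f
∈-tabulate⁺ f {v} fv =
  lookup⇒[]= v (tabulate f) (trans (lookup∘tabulate f v) (Equivalence.to T-≡ fv))

Catches : Subset n → Subset n → Fin n → Set
Catches F e v = v ∈ e × 2 ≤ ∣ e ∣ × e - v ⊆ F

catchesᵇ-sound : ∀ (F e : Subset n) v → T (catchesᵇ F e v) → Catches F e v
catchesᵇ-sound F e v c
  with v∈e , rest ← Equivalence.to (T-∧ {does (v ∈? e)}) c
  with big , e-v⊆F ← Equivalence.to (T-∧ {2 ≤ᵇ ∣ e ∣}) rest
  = T-does⁻ (v ∈? e) v∈e , ≤ᵇ⇒≤ 2 ∣ e ∣ big , T-does⁻ (e - v ⊆? F) e-v⊆F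

catchesᵇ-complete : ∀ (F e : Subset n) v → Catches F e v → T (catchesᵇ F e v)
catchesᵇ-complete F e v (v∈e , big , e-v⊆F) =
  Equivalence.from T-∧
    (T-does⁺ (v ∈? e) v∈e , Equivalence.from T-∧ (≤⇒≤ᵇ big , T-does⁺ (e - v ⊆? F) e-v⊆F))

Catches-mono : ∀ {F F' e : Subset n} {v} → F ⊆ F' → Catches F e v → Catches F' e v
Catches-mono F⊆F' (v∈e , big , e-v⊆F) = v∈e , big , F⊆F' ∘ e-v⊆F

∈-spread⁻ : ∀ (E : List (Subset n)) F {v} → v ∈ spread E F → ∃[ e ] (e ∈ˡ E × Catches F e v)
∈-spread⁻ E F {v} v∈spread
  with e , e∈E , c ← find (any⁻ (λ e → catchesᵇ F e v) E (∈-tabulate⁻ _ v∈spread))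
  = e , e∈E , catchesᵇ-sound F e v c

∈-spread⁺ : ∀ (E : List (Subset n)) F {e v} → e ∈ˡ E → Catches F e v → v ∈ spread E F
∈-spread⁺ E F {e} {v} e∈E c =
  ∈-tabulate⁺ _ (any⁺ (λ e → catchesᵇ F e v) (lose e∈E (catchesᵇ-complete F e v c)))

burnt⊆step : ∀ (E : List (Subset n)) F u → F ⊆ step E F u
burnt⊆step E F u = p⊆p∪q _

spread⊆step : ∀ (E : List (Subset n)) F u → spread E F ⊆ step E F u
spread⊆step E F u = q⊆p∪q F _ ∘ p⊆p∪q _

source∈step : ∀ (E : List (Subset n)) F u → u ∈ step E F u
source∈step E F u = q⊆p∪q F _ (q⊆p∪q _ _ (x∈⁅x⁆ u))

step-⊆ : ∀ {E : List (Subset n)} {F u X} → F ⊆ X → spread E F ⊆ X → u ∈ X → step E F u ⊆ X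
step-⊆ {E = E} {F} {u} F⊆X spread⊆X u∈X v∈step with x∈p∪q⁻ F _ v∈step
... | inj₁ v∈F = F⊆X v∈F
... | inj₂ v∈rest with x∈p∪q⁻ (spread E F) _ v∈rest
...   | inj₁ v∈spread = spread⊆X v∈spread
...   | inj₂ v∈⁅u⁆ rewrite x∈⁅y⁆⇒x≡y u v∈⁅u⁆ = u∈X

-- Inclusion up to empty edges: these never ignite anything, and an empty edge of the
-- strong subhypergraph has no counterpart in the weak one.
_⊑_ : List (Subset n) → List (Subset n) → Set
E ⊑ E' = ∀ {e} → e ∈ˡ E → Nonempty e → e ∈ˡ E'

EdgesWithin : Subset n → List (Subset n) → Set
EdgesWithin V E = ∀ {e} → e ∈ˡ E → e ⊆ V

spread-mono : ∀ {E E' : List (Subset n)} {F F'} → E ⊑ E' → F ⊆ F' → spread E F ⊆ spread E' F'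
spread-mono {E = E} {E'} {F} {F'} E⊑E' F⊆F' v∈spread
  with e , e∈E , c ← ∈-spread⁻ E F v∈spread =
  ∈-spread⁺ E' F' (E⊑E' e∈E (_ , proj₁ c)) (Catches-mono F⊆F' c)

spread-within : ∀ {V : Subset n} {E F} → EdgesWithin V E → spread E F ⊆ V
spread-within {E = E} {F} E⊆V v∈spread
  with e , e∈E , c ← ∈-spread⁻ E F v∈spread = E⊆V e∈E (proj₁ c)

LazyBurnt-mono : ∀ {V V' : Subset n} {E E' S v} → E ⊑ E' →
                 LazyBurnt (mkHypergraph V E) S v → LazyBurnt (mkHypergraph V' E') S v
LazyBurnt-mono E⊑E' (source v∈S) = source v∈S
LazyBurnt-mono E⊑E' (spreadTo e e∈E v∈e big rest) =
  spreadTo e (E⊑E' e∈E (_ , v∈e)) v∈e big (λ w w∈e w≢v → LazyBurnt-mono E⊑E' (rest w w∈e w≢v))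

lazyBurningNumber-mono : ∀ {V : Subset n} {E E' l l'} → E ⊑ E' →
                         IsLazyBurningNumber (mkHypergraph V E) l →
                         IsLazyBurningNumber (mkHypergraph V E') l' → l' ≤ l
lazyBurningNumber-mono E⊑E' ((S , (S⊆V , burns) , refl) , _) (_ , minimal') =
  minimal' S (S⊆V , λ v v∈V → LazyBurnt-mono E⊑E' (burns v v∈V))

module Replay {V : Subset n} {E E' : List (Subset n)} (E⊑E' : E ⊑ E') (E'⊆V : EdgesWithin V E') where

  nextSource : ∀ F' u → u ∈ V → V ⊆ F' ⊎ ∃[ u' ] (u' ∈ V × u' ∉ F' × u ∈ step E' F' u')
  nextSource F' u u∈V with u ∈? F'
  ... | no u∉F' = inj₂ (u , u∈V , u∉F' , source∈step E' F' u)
  ... | yes u∈F' with ⊆-or-witness V F'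
  ...   | inj₁ V⊆F'             = inj₁ V⊆F'
  ...   | inj₂ (x , x∈V , x∉F') = inj₂ (x , x∈V , x∉F' , burnt⊆step E' F' x u∈F')

  step-mono : ∀ {F F' u u'} → F ⊆ F' → u ∈ step E' F' u' → step E F u ⊆ step E' F' u'
  step-mono {F} {F'} {u} {u'} F⊆F' u∈step' =
    step-⊆ {E = E} {F} {u} (burnt⊆step E' F' u' ∘ F⊆F')
                           (spread⊆step E' F' u' ∘ spread-mono {E = E} {E'} E⊑E' F⊆F')
                           u∈step'

  step-within : ∀ {F' u'} → F' ⊆ V → u' ∈ V → step E' F' u' ⊆ V
  step-within {F'} {u'} F'⊆V u'∈V = step-⊆ {E = E'} {F'} {u'} F'⊆V (spread-within E'⊆V) u'∈V

  replay : ∀ F F' us → F ⊆ F' → F' ⊆ V →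
           ValidSources (mkHypergraph V E) F us → burnFrom E F us ≡ V →
           ∃[ us' ] (ValidSources (mkHypergraph V E') F' us' × burnFrom E' F' us' ≡ V
                     × length us' ≤ length us)
  replay F F' [] F⊆F' F'⊆V _ refl = [] , tt , ⊆-antisym F'⊆V F⊆F' , z≤n
  replay F F' (u ∷ us) F⊆F' F'⊆V (u∈V , _ , valid) burnt with nextSource F' u u∈V
  ... | inj₁ V⊆F' = [] , tt , ⊆-antisym F'⊆V V⊆F' , z≤n
  ... | inj₂ (u' , u'∈V , u'∉F' , u∈step')
    with us' , valid' , burnt' , shorter ← replay (step E F u) (step E' F' u') us
                                             (step-mono F⊆F' u∈step') (step-within F'⊆V u'∈V) valid burnt
    = u' ∷ us' , (u'∈V , u'∉F' , valid') , burnt' , s≤s shorter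

burningNumber-mono : ∀ {V : Subset n} {E E' b b'} → E ⊑ E' → EdgesWithin V E' →
                     IsBurningNumber (mkHypergraph V E) b →
                     IsBurningNumber (mkHypergraph V E') b' → b' ≤ b
burningNumber-mono E⊑E' E'⊆V ((us , (valid , burnt) , refl) , _) (_ , minimal')
  with us' , valid' , burnt' , shorter ← Replay.replay E⊑E' E'⊆V ⊥ ⊥ us ⊆-refl ⊥⊆ valid burnt
  = ≤-trans (minimal' us' (valid' , burnt')) shorter

strongSub⊑weakSub : ∀ (H : Hypergraph n) I → edges (strongSub H I) ⊑ edges (weakSub H I)
strongSub⊑weakSub H I {e} e∈strong e≠∅
  with e∈H , e⊆I ← ∈-filter⁻ (_⊆? I) {xs = edges H} e∈strong =
  subst (_∈ˡ edges (weakSub H I)) e∩I≡e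
    (∈-map⁺ (_∩ I) (∈-filter⁺ (nonempty? ∘ (_∩ I)) e∈H (subst Nonempty (sym e∩I≡e) e≠∅)))
  where
    e∩I≡e : e ∩ I ≡ e
    e∩I≡e = p⊆q⇒p∩q≡p e⊆I

weakSub-within : ∀ (H : Hypergraph n) I → EdgesWithin I (edges (weakSub H I))
weakSub-within H I e∈weak with e , _ , refl ← ∈-map⁻ (_∩ I) e∈weak = p∩q⊆q e I

mainTheorem17 : (n : ℕ) (E : List (Subset n)) (I : Subset n) → Nonempty I →
    (∀ b₁ b₂ → IsBurningNumber (strongSub (fullHypergraph E) I) b₁ →
               IsBurningNumber (weakSub (fullHypergraph E) I) b₂ → b₂ ≤ b₁)
    × (∀ l₁ l₂ → IsLazyBurningNumber (strongSub (fullHypergraph E) I) l₁ →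
                 IsLazyBurningNumber (weakSub (fullHypergraph E) I) l₂ → l₂ ≤ l₁)
mainTheorem17 n E I _ =
    (λ _ _ → burningNumber-mono (strongSub⊑weakSub H I) (weakSub-within H I))
  , (λ _ _ → lazyBurningNumber-mono (strongSub⊑weakSub H I))
  where
    H : Hypergraph n
    H = fullHypergraph E
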